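{- Let $G$ be a nice graph. Then, for every set $W$ of $|E(G)|+2\Delta(G)$ distinct strictly positive integers, there exists an edge-injective neighbour-sum-distinguishing $W$-edge-weighting of $G$. In particular, $\chi^{e,1}_\Sigma(G)\leq |E(G)|+2\Delta(G)$.
   Context: All graphs are finite, simple, undirected and loopless; $\Delta(G)$ is the maximum degree. A graph is nice if none of its connected components is isomorphic to $K_2$. For a set $W$ of weights, a $W$-edge-weighting of $G$ is a map $w:E(G)\to W$; a $k$-edge-weighting is a $\{1,\dots,k\}$-edge-weighting. For a vertex $v$, $\sigma_w(v)=\sum_{u\in N(v)} w(vu)$. The weighting $w$ is neighbour-sum-distinguishing if $\sigma_w(u)\neq\sigma_w(v)$ for every edge $uv$, and edge-injective if no two distinct edges receive the same weight. For a nice graph $G$, $\chi^{e,1}_\Sigma(G)$ is the smallest $k$ such that $G$ admits an edge-injective neighbour-sum-distinguishing $k$-edge-weighting. -}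

module Defs where

open import Data.Nat using (ℕ; zero; suc; _+_; _*_; _<_; _⊔_)
open import Data.Fin using (Fin; toℕ; _≟_)
open import Data.Bool using (Bool; _∨_; if_then_else_; T?)
open import Data.Product using (_×_; _,_; proj₁; proj₂; Σ)
open import Data.List using (List; length; lookup; allFin; map; foldr; filter)
open import Data.Nat.ListAction using (sum)
open import Data.List.Relation.Unary.All using (All)
open import Data.List.Relation.Unary.Unique.Propositional using (Unique)
open import Data.List.Membership.Propositional using (_∈_)
open import Relation.Nullary using (¬_; does)
open import Relation.Binary.PropositionalEquality using (_≡_)
open import Function.Definitions using (Injective)

-- Each edge {u,v} is stored exactly once as an ordered pair (u , v) with
-- toℕ u < toℕ v (this excludes loops and fixes an orientation), and the
-- edge list has no repetitions (no multi-edges).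
record Graph : Set where
  field
    n      : ℕ
    edges  : List (Fin n × Fin n)
    ordered : All (λ e → toℕ (proj₁ e) < toℕ (proj₂ e)) edges
    simple  : Unique edges

module _ (G : Graph) where
  open Graph G

  m : ℕ
  m = length edges

  Edge : Set
  Edge = Fin m

  endpoints : Edge → Fin n × Fin n
  endpoints i = lookup edges i

  incidentᵇ : Fin n → Fin n × Fin n → Bool
  incidentᵇ v (a , b) = does (v ≟ a) ∨ does (v ≟ b)

  degree : Fin n → ℕ
  degree v = foldr (λ e acc → if incidentᵇ v e then suc acc else acc) 0 edges

  Δ : ℕ
  Δ = foldr _⊔_ 0 (map degree (allFin n))

  -- nice: no connected component isomorphic to K₂, i.e. there is no edge
  -- both of whose endpoints have degree 1.
  Nice : Set
  Nice = (i : Edge) → ¬ (degree (proj₁ (endpoints i)) ≡ 1 × degree (proj₂ (endpoints i)) ≡ 1)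

  Weighting : Set
  Weighting = Edge → ℕ

  σ : Weighting → Fin n → ℕ
  σ w v = sum (map w (filter (λ i → T? (incidentᵇ v (endpoints i))) (allFin m)))

  IsWWeighting : List ℕ → Weighting → Set
  IsWWeighting W w = (i : Edge) → w i ∈ W

  EdgeInjective : Weighting → Set
  EdgeInjective w = Injective _≡_ _≡_ w

  NeighbourSumDistinguishing : Weighting → Set
  NeighbourSumDistinguishing w =
    (i : Edge) → ¬ (σ w (proj₁ (endpoints i)) ≡ σ w (proj₂ (endpoints i)))

-- Weight the edges one at a time in index order, unweighted edges counting as 0.
-- The endpoint sums of an edge j are final as soon as every edge adjacent to j is
-- weighted, so it suffices to keep such settled edges distinguished.  Giving the
-- next edge e = ab a weight c adds c to σ(a) and σ(b) only: e itself stays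
-- distinguished, no other edge has both ends in {a, b} (the graph is simple), and
-- an edge j meeting e in one end becomes a conflict only if c is the current gap
-- |σ(x) − σ(y)| of j = xy.  So c has to avoid the fewer than |E| weights used so
-- far and the deg a + deg b gaps of edges at a or b, fewer than |W| values in all.
-- An edge with no neighbour would be settled from the start with both sums equal;
-- niceness rules it out.
module Submission where

open import Defs
open import Data.Nat using (ℕ; _+_; _*_; _<_)
open import Data.Product using (Σ; _×_)
open import Data.List using (List; length)
open import Relation.Binary.PropositionalEquality using (_≡_)
open import Data.List.Relation.Unary.All using (All)
open import Data.List.Relation.Unary.Unique.Propositional using (Unique)

open import Data.Nat using (zero; suc; _≤_; _⊔_; ∣_-_∣; s≤s⁻¹)
open import Data.Nat.Properties hiding (_≟_)
open import Data.Nat.ListAction using (sum)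
open import Data.Fin using (Fin; Fin′; toℕ; zero; suc; inject; fromℕ<; punchIn; _≟_)
open import Data.Fin.Properties
  using (toℕ-injective; toℕ-inject; toℕ-fromℕ<; toℕ<n; punchInᵢ≢i)
open import Data.Bool using (Bool; true; false; if_then_else_; T; T?)
open import Data.Bool.Properties using (∨-zeroʳ; ¬-not)
open import Data.Product using (∃; ∃-syntax; _,_; proj₁; proj₂)
open import Data.Sum using (_⊎_; inj₁; inj₂)
open import Data.List using ([]; _∷_; _++_; lookup; allFin; map; foldr; filter; tabulate)
open import Data.List.Properties
  using (length-++; length-map; length-tabulate; map-tabulate; length-removeAt′)
import Data.List.Relation.Unary.All as All
open import Data.List.Relation.Unary.Any using (here; there; index)
open import Data.List.Relation.Unary.AllPairs using (_∷_)
open import Data.List.Membership.Propositional using (_∈_; _∉_; _─_)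
open import Data.List.Membership.Propositional.Properties
  using (∈-lookup; ∈-allFin; ∈-map⁺; ∈-filter⁺; ∈-tabulate⁺; ∈-++⁺ˡ; ∈-++⁺ʳ)
open import Data.List.Membership.DecPropositional (Data.Nat.Properties._≟_) using (_∈?_)
open import Relation.Nullary using (does; yes; no; contradiction)
open import Relation.Nullary.Decidable using (dec-true; dec-false)
open import Relation.Binary.PropositionalEquality
  using (_≢_; refl; sym; trans; cong; cong₂; subst; subst₂; module ≡-Reasoning)
open import Algebra.Properties.CommutativeMonoid.Sum +-0-commutativeMonoid
  using (sum-syntax; sum-remove; sum-cong-≗; sum-replicate-zero; ∑-distrib-+)

∑-single : ∀ {m} (f : Fin m → ℕ) (e : Fin m) → (∀ i → i ≢ e → f i ≡ 0) →
           ∑[ i < m ] f i ≡ f e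
∑-single {suc m} f e vanishes = begin
  ∑[ i < suc m ] f i               ≡⟨ sum-remove {i = e} f ⟩
  f e + ∑[ i < m ] f (punchIn e i)  ≡⟨ cong (f e +_) (sum-cong-≗ (λ i → vanishes _ (punchInᵢ≢i e i))) ⟩
  f e + ∑[ i < m ] 0               ≡⟨ cong (f e +_) (sum-replicate-zero m) ⟩
  f e + 0                          ≡⟨ +-identityʳ (f e) ⟩
  f e                              ∎
  where open ≡-Reasoning

sum-tabulate : ∀ {m} (f : Fin m → ℕ) → sum (tabulate f) ≡ ∑[ i < m ] f i
sum-tabulate {zero}  f = refl
sum-tabulate {suc m} f = cong (f zero +_) (sum-tabulate (λ i → f (suc i)))

sum-map-filter : ∀ {A : Set} (p : A → Bool) (f : A → ℕ) (xs : List A) →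
                 sum (map f (filter (λ x → T? (p x)) xs)) ≡ sum (map (λ x → if p x then f x else 0) xs)
sum-map-filter p f []       = refl
sum-map-filter p f (x ∷ xs) with p x
... | true  = cong (f x +_) (sum-map-filter p f xs)
... | false = sum-map-filter p f xs

length≡sum-map-1 : ∀ {A : Set} (xs : List A) → length xs ≡ sum (map (λ _ → 1) xs)
length≡sum-map-1 []       = refl
length≡sum-map-1 (x ∷ xs) = cong suc (length≡sum-map-1 xs)

foldr-count≡∑ : ∀ {A : Set} (p : A → Bool) (xs : List A) →
                foldr (λ x acc → if p x then suc acc else acc) 0 xs
                  ≡ ∑[ i < length xs ] (if p (lookup xs i) then 1 else 0)
foldr-count≡∑ p []       = refl
foldr-count≡∑ p (x ∷ xs) with p x
... | true  = cong suc (foldr-count≡∑ p xs)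
... | false = foldr-count≡∑ p xs

if-distrib-+ : ∀ b x y → (if b then x + y else 0) ≡ (if b then x else 0) + (if b then y else 0)
if-distrib-+ true  x y = refl
if-distrib-+ false x y = refl

if-const-0 : ∀ b → (if b then 0 else 0) ≡ 0
if-const-0 true  = refl
if-const-0 false = refl

∈⇒≤foldr-⊔ : ∀ {x} {xs : List ℕ} → x ∈ xs → x ≤ foldr _⊔_ 0 xs
∈⇒≤foldr-⊔ {xs = y ∷ xs} (here refl) = m≤m⊔n y _
∈⇒≤foldr-⊔ {xs = y ∷ xs} (there x∈) = ≤-trans (∈⇒≤foldr-⊔ x∈) (m≤n⊔m y _)

m+n≡o⇒n≡∣m-o∣ : ∀ {m n o} → m + n ≡ o → n ≡ ∣ m - o ∣
m+n≡o⇒n≡∣m-o∣ {m} {n} refl = sym (∣m-m+n∣≡n m n)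

Unique⇒lookup-injective : ∀ {A : Set} {xs : List A} → Unique xs →
                          ∀ {i j} → lookup xs i ≡ lookup xs j → i ≡ j
Unique⇒lookup-injective {xs = x ∷ xs} _        {zero}  {zero}  _  = refl
Unique⇒lookup-injective {xs = x ∷ xs} (x∉ ∷ _) {zero}  {suc j} eq =
  contradiction eq (All.lookup x∉ (∈-lookup j))
Unique⇒lookup-injective {xs = x ∷ xs} (x∉ ∷ _) {suc i} {zero}  eq =
  contradiction (sym eq) (All.lookup x∉ (∈-lookup i))
Unique⇒lookup-injective {xs = x ∷ xs} (_ ∷ u)  {suc i} {suc j} eq =
  cong suc (Unique⇒lookup-injective u eq)

∈-─⁺ : ∀ {A : Set} {x y : A} {xs} (x∈xs : x ∈ xs) → y ∈ xs → y ≢ x → y ∈ xs ─ x∈xs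
∈-─⁺ (here refl) (here refl) y≢x = contradiction refl y≢x
∈-─⁺ (here refl) (there y∈)  _   = y∈
∈-─⁺ (there x∈)  (here refl) _   = here refl
∈-─⁺ (there x∈)  (there y∈)  y≢x = there (∈-─⁺ x∈ y∈ y≢x)

pigeonhole-∉ : ∀ {W F : List ℕ} → Unique W → length F < length W → ∃[ c ] c ∈ W × c ∉ F
pigeonhole-∉ {x ∷ W} {F} (x≢W ∷ uniq) |F|<|W| with x ∈? F
... | no x∉F = x , here refl , x∉F
... | yes x∈F
  with c , c∈W , c∉F─x ← pigeonhole-∉ {W} {F ─ x∈F} uniq
         (subst (_≤ length W) (length-removeAt′ F (index x∈F)) (s≤s⁻¹ |F|<|W|))
  = c , there c∈W , λ c∈F → c∉F─x (∈-─⁺ x∈F c∈F λ c≡x → All.lookup x≢W c∈W (sym c≡x))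

-- opaque, so that case splits on i ≟ e do not reach inside w i + point e c i
opaque
  point : ∀ {m} → Fin m → ℕ → Fin m → ℕ
  point e c i = if does (i ≟ e) then c else 0

  point-≡ : ∀ {m} (e : Fin m) c → point e c e ≡ c
  point-≡ e c rewrite dec-true (e ≟ e) refl = refl

  point-≢ : ∀ {m} {e i : Fin m} c → i ≢ e → point e c i ≡ 0
  point-≢ {e = e} {i} c i≢e rewrite dec-false (i ≟ e) i≢e = refl

module _ (G : Graph) where
  open Graph G

  src tgt : Edge G → Fin n
  src j = proj₁ (endpoints G j)
  tgt j = proj₂ (endpoints G j)

  src<tgt : ∀ j → toℕ (src j) < toℕ (tgt j)
  src<tgt j = All.lookup ordered (∈-lookup j)

  -- opaque, so that v and i can be inferred from touches v i ≡ b
  opaque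
    touches : Fin n → Edge G → Bool
    touches v i = incidentᵇ G v (endpoints G i)

    touches-src : ∀ j → touches (src j) j ≡ true
    touches-src j rewrite dec-true (src j ≟ src j) refl = refl

    touches-tgt : ∀ j → touches (tgt j) j ≡ true
    touches-tgt j rewrite dec-true (tgt j ≟ tgt j) refl = ∨-zeroʳ _

    touches⇒endpoint : ∀ {v i} → touches v i ≡ true → v ≡ src i ⊎ v ≡ tgt i
    touches⇒endpoint {v} {i} _ with v ≟ src i | v ≟ tgt i
    ... | yes v≡s | _       = inj₁ v≡s
    ... | no _    | yes v≡t = inj₂ v≡t
    touches⇒endpoint () | no _ | no _

  both-ends-touch⇒≡ : ∀ {e j} → touches (src j) e ≡ true → touches (tgt j) e ≡ true → e ≡ j
  both-ends-touch⇒≡ {e} {j} s t with touches⇒endpoint s | touches⇒endpoint t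
  ... | inj₁ s≡ | inj₁ t≡ = contradiction (cong toℕ (trans s≡ (sym t≡))) (<⇒≢ (src<tgt j))
  ... | inj₂ s≡ | inj₂ t≡ = contradiction (cong toℕ (trans s≡ (sym t≡))) (<⇒≢ (src<tgt j))
  ... | inj₂ s≡ | inj₁ t≡ =
    contradiction (subst₂ _<_ (cong toℕ s≡) (cong toℕ t≡) (src<tgt j)) (<-asym (src<tgt e))
  ... | inj₁ s≡ | inj₂ t≡ = Unique⇒lookup-injective simple (cong₂ _,_ (sym s≡) (sym t≡))

  incident : Fin n → List (Edge G)
  incident v = filter (λ i → T? (touches v i)) (allFin (m G))

  ∈-incident : ∀ {v j} → touches v j ≡ true → j ∈ incident v
  ∈-incident {v} {j} v-j = ∈-filter⁺ (λ i → T? (touches v i)) (∈-allFin j) (subst T (sym v-j) _)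

  _↾_ : Weighting G → Fin n → Weighting G
  (w ↾ v) i = if touches v i then w i else 0

  opaque
    unfolding touches
    σ-as-∑ : ∀ w v → σ G w v ≡ ∑[ i < m G ] (w ↾ v) i
    σ-as-∑ w v = begin
      σ G w v                             ≡⟨ sum-map-filter (touches v) w (allFin (m G)) ⟩
      sum (map (w ↾ v) (allFin (m G)))     ≡⟨ cong sum (map-tabulate (λ i → i) (w ↾ v)) ⟩
      sum (tabulate (w ↾ v))              ≡⟨ sum-tabulate (w ↾ v) ⟩
      ∑[ i < m G ] (w ↾ v) i              ∎
      where open ≡-Reasoning

    degree≡σ-1 : ∀ v → degree G v ≡ σ G (λ _ → 1) v
    degree≡σ-1 v = trans (foldr-count≡∑ (incidentᵇ G v) edges) (sym (σ-as-∑ _ v))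

    length-incident : ∀ v → length (incident v) ≡ degree G v
    length-incident v = trans (length≡sum-map-1 (incident v)) (sym (degree≡σ-1 v))

  σ-+ : ∀ w w′ v → σ G (λ i → w i + w′ i) v ≡ σ G w v + σ G w′ v
  σ-+ w w′ v = begin
    σ G (λ i → w i + w′ i) v                         ≡⟨ σ-as-∑ _ v ⟩
    ∑[ i < m G ] ((λ i → w i + w′ i) ↾ v) i          ≡⟨ sum-cong-≗ (λ i → if-distrib-+ (touches v i) (w i) (w′ i)) ⟩
    ∑[ i < m G ] ((w ↾ v) i + (w′ ↾ v) i)            ≡⟨ ∑-distrib-+ (w ↾ v) (w′ ↾ v) ⟩
    ∑[ i < m G ] (w ↾ v) i + ∑[ i < m G ] (w′ ↾ v) i ≡⟨ sym (cong₂ _+_ (σ-as-∑ w v) (σ-as-∑ w′ v)) ⟩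
    σ G w v + σ G w′ v                               ∎
    where open ≡-Reasoning

  σ-point : ∀ e c v → σ G (point e c) v ≡ (if touches v e then c else 0)
  σ-point e c v = begin
    σ G (point e c) v               ≡⟨ σ-as-∑ (point e c) v ⟩
    ∑[ i < m G ] (point e c ↾ v) i  ≡⟨ ∑-single (point e c ↾ v) e vanishes ⟩
    (point e c ↾ v) e               ≡⟨ cong (λ x → if touches v e then x else 0) (point-≡ e c) ⟩
    (if touches v e then c else 0)  ∎
    where
    open ≡-Reasoning
    vanishes : ∀ i → i ≢ e → (point e c ↾ v) i ≡ 0
    vanishes i i≢e rewrite point-≢ c i≢e = if-const-0 (touches v i)

  degree≤Δ : ∀ v → degree G v ≤ Δ G
  degree≤Δ v = ∈⇒≤foldr-⊔ (∈-map⁺ (degree G) (∈-allFin v))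

  degree≡1 : ∀ {v j} → touches v j ≡ true → (∀ i → i ≢ j → touches v i ≡ false) → degree G v ≡ 1
  degree≡1 {v} {j} v-j only-j = begin
    degree G v                                   ≡⟨ degree≡σ-1 v ⟩
    σ G (λ _ → 1) v                              ≡⟨ σ-as-∑ (λ _ → 1) v ⟩
    ∑[ i < m G ] ((λ _ → 1) ↾ v) i                ≡⟨ ∑-single ((λ _ → 1) ↾ v) j vanishes ⟩
    ((λ _ → 1) ↾ v) j                            ≡⟨ cong (λ b → if b then 1 else 0) v-j ⟩
    1                                            ∎
    where
    open ≡-Reasoning
    vanishes : ∀ i → i ≢ j → ((λ _ → 1) ↾ v) i ≡ 0
    vanishes i i≢j = cong (λ b → if b then 1 else 0) (only-j i i≢j)

  Adjacent : Edge G → Edge G → Set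
  Adjacent i j = touches (src j) i ≡ true ⊎ touches (tgt j) i ≡ true

  -- the endpoint sums of j are final once the first k edges are weighted
  Settled : ℕ → Edge G → Set
  Settled k j = ∀ i → i ≢ j → Adjacent i j → toℕ i < k

  <suc⇒< : ∀ {i e : Edge G} → toℕ i < suc (toℕ e) → i ≢ e → toℕ i < toℕ e
  <suc⇒< i≤e i≢e = ≤∧≢⇒< (s≤s⁻¹ i≤e) (λ eq → i≢e (toℕ-injective eq))

  Settled-suc⇒Settled : ∀ {e j} → (Adjacent e j → e ≡ j) → Settled (suc (toℕ e)) j → Settled (toℕ e) j
  Settled-suc⇒Settled e-adj⇒e≡j settled i i≢j adj =
    <suc⇒< (settled i i≢j adj) λ { refl → i≢j (e-adj⇒e≡j adj) }

  module _ (W : List ℕ) where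

    record Partial (k : ℕ) (w : Weighting G) : Set where
      field
        unassigned-zero       : ∀ i → k ≤ toℕ i → w i ≡ 0
        assigned-∈            : ∀ i → toℕ i < k → w i ∈ W
        assigned-injective    : ∀ {i j} → toℕ i < k → toℕ j < k → w i ≡ w j → i ≡ j
        settled-distinguished : ∀ j → Settled k j → σ G w (src j) ≢ σ G w (tgt j)

    partial₀ : Nice G → Partial 0 (λ _ → 0)
    partial₀ nice = record
      { unassigned-zero       = λ _ _ → refl
      ; assigned-∈            = λ _ ()
      ; assigned-injective    = λ ()
      ; settled-distinguished = λ j settled _ →
          nice j ( degree≡1 (touches-src j) (λ i i≢j → ¬-not λ s → n≮0 (settled i i≢j (inj₁ s)))
                 , degree≡1 (touches-tgt j) (λ i i≢j → ¬-not λ t → n≮0 (settled i i≢j (inj₂ t))))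
      }

    module Extension (e : Edge G) {w : Weighting G} (P : Partial (toℕ e) w) where
      open Partial P

      gap : Edge G → ℕ
      gap j = ∣ σ G w (src j) - σ G w (tgt j) ∣

      used : List ℕ
      used = tabulate (λ (i : Fin′ e) → w (inject i))

      gaps : Fin n → List ℕ
      gaps v = map gap (incident v)

      forbidden : List ℕ
      forbidden = used ++ gaps (src e) ++ gaps (tgt e)

      length-forbidden : length forbidden ≡ toℕ e + (degree G (src e) + degree G (tgt e))
      length-forbidden = begin
        length forbidden
          ≡⟨ length-++ used ⟩
        length used + length (gaps (src e) ++ gaps (tgt e))
          ≡⟨ cong₂ _+_ (length-tabulate {n = toℕ e} (λ i → w (inject i))) (length-++ (gaps (src e)) {gaps (tgt e)}) ⟩
        toℕ e + (length (gaps (src e)) + length (gaps (tgt e)))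
          ≡⟨ cong (toℕ e +_) (cong₂ _+_ (length-gaps (src e)) (length-gaps (tgt e))) ⟩
        toℕ e + (degree G (src e) + degree G (tgt e))
          ∎
        where
        open ≡-Reasoning
        length-gaps : ∀ v → length (gaps v) ≡ degree G v
        length-gaps v = trans (length-map gap (incident v)) (length-incident v)

      assigned∈forbidden : ∀ {i} → toℕ i < toℕ e → w i ∈ forbidden
      assigned∈forbidden {i} i<e = ∈-++⁺ˡ (subst (λ i → w i ∈ used) i≡ (∈-tabulate⁺ (fromℕ< i<e)))
        where
        i≡ : inject (fromℕ< i<e) ≡ i
        i≡ = toℕ-injective (trans (toℕ-inject (fromℕ< i<e)) (toℕ-fromℕ< i<e))

      gap∈forbidden : ∀ {x j} → touches x e ≡ true → touches x j ≡ true → gap j ∈ forbidden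
      gap∈forbidden {x} x-e x-j with touches⇒endpoint {x} {e} x-e
      ... | inj₁ refl = ∈-++⁺ʳ used (∈-++⁺ˡ (∈-map⁺ gap (∈-incident x-j)))
      ... | inj₂ refl = ∈-++⁺ʳ used (∈-++⁺ʳ (gaps (src e)) (∈-map⁺ gap (∈-incident x-j)))

      module _ {c} (c∈W : c ∈ W) (c∉forbidden : c ∉ forbidden) where

        w′ : Weighting G
        w′ i = w i + point e c i

        w′-e : w′ e ≡ c
        w′-e = cong₂ _+_ (unassigned-zero e ≤-refl) (point-≡ e c)

        w′-≢ : ∀ {i} → i ≢ e → w′ i ≡ w i
        w′-≢ {i} i≢e = trans (cong (w i +_) (point-≢ c i≢e)) (+-identityʳ (w i))

        σ-w′ : ∀ {x b} → touches x e ≡ b → σ G w′ x ≡ σ G w x + (if b then c else 0)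
        σ-w′ {x} refl = trans (σ-+ w (point e c) x) (cong (σ G w x +_) (σ-point e c x))

        w′-≢c : ∀ {i} → toℕ i < suc (toℕ e) → i ≢ e → w′ i ≢ c
        w′-≢c i≤e i≢e w′i≡c =
          c∉forbidden (subst (_∈ forbidden) (trans (sym (w′-≢ i≢e)) w′i≡c)
                                            (assigned∈forbidden (<suc⇒< i≤e i≢e)))

        equal-shift : ∀ {x y b} → touches x e ≡ b → touches y e ≡ b →
                      σ G w′ x ≡ σ G w′ y → σ G w x ≡ σ G w y
        equal-shift x-e y-e eq = +-cancelʳ-≡ _ _ _ (trans (sym (σ-w′ x-e)) (trans eq (σ-w′ y-e)))

        shifted-once : ∀ {x y} → touches x e ≡ true → touches y e ≡ false →
                       σ G w′ x ≡ σ G w′ y → c ≡ ∣ σ G w x - σ G w y ∣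
        shifted-once x-e y-e eq =
          m+n≡o⇒n≡∣m-o∣ (trans (sym (σ-w′ x-e)) (trans eq (trans (σ-w′ y-e) (+-identityʳ _))))

        distinguished : ∀ j → Settled (suc (toℕ e)) j → σ G w′ (src j) ≢ σ G w′ (tgt j)
        distinguished j settled eq with e ≟ j
        ... | yes refl =
          settled-distinguished e (Settled-suc⇒Settled (λ _ → refl) settled)
            (equal-shift (touches-src e) (touches-tgt e) eq)
        ... | no e≢j with touches (src j) e in s | touches (tgt j) e in t
        ...   | true  | true  = e≢j (both-ends-touch⇒≡ s t)
        ...   | false | false =
          settled-distinguished j (Settled-suc⇒Settled e-not-adjacent settled) (equal-shift s t eq)
          where
          e-not-adjacent : Adjacent e j → e ≡ j
          e-not-adjacent (inj₁ s′) = contradiction (trans (sym s) s′) λ ()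
          e-not-adjacent (inj₂ t′) = contradiction (trans (sym t) t′) λ ()
        ...   | true  | false =
          c∉forbidden (subst (_∈ forbidden) (sym (shifted-once s t eq)) (gap∈forbidden s (touches-src j)))
        ...   | false | true  =
          c∉forbidden (subst (_∈ forbidden) (sym c≡gap) (gap∈forbidden t (touches-tgt j)))
          where
          c≡gap : c ≡ gap j
          c≡gap = trans (shifted-once t s (sym eq)) (∣-∣-comm (σ G w (tgt j)) (σ G w (src j)))

        extended : Partial (suc (toℕ e)) w′
        extended = record
          { unassigned-zero       = zero-beyond
          ; assigned-∈            = in-W
          ; assigned-injective    = injective
          ; settled-distinguished = distinguished
          }
          where
          zero-beyond : ∀ i → suc (toℕ e) ≤ toℕ i → w′ i ≡ 0
          zero-beyond i e<i = trans (w′-≢ λ { refl → n≮n _ e<i }) (unassigned-zero i (<⇒≤ e<i))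

          in-W : ∀ i → toℕ i < suc (toℕ e) → w′ i ∈ W
          in-W i i≤e with i ≟ e
          ... | yes refl = subst (_∈ W) (sym w′-e) c∈W
          ... | no i≢e   = subst (_∈ W) (sym (w′-≢ i≢e)) (assigned-∈ i (<suc⇒< i≤e i≢e))

          injective : ∀ {i j} → toℕ i < suc (toℕ e) → toℕ j < suc (toℕ e) → w′ i ≡ w′ j → i ≡ j
          injective {i} {j} i≤e j≤e eq with i ≟ e | j ≟ e
          ... | yes refl | yes refl = refl
          ... | yes refl | no j≢e   = contradiction (trans (sym eq) w′-e) (w′-≢c j≤e j≢e)
          ... | no i≢e   | yes refl = contradiction (trans eq w′-e) (w′-≢c i≤e i≢e)
          ... | no i≢e   | no j≢e   =
            assigned-injective (<suc⇒< i≤e i≢e) (<suc⇒< j≤e j≢e) (trans (sym (w′-≢ i≢e)) (trans eq (w′-≢ j≢e)))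

      forbidden-shorter : length W ≡ m G + 2 * Δ G → length forbidden < length W
      forbidden-shorter |W| = begin-strict
        length forbidden                                ≡⟨ length-forbidden ⟩
        toℕ e + (degree G (src e) + degree G (tgt e))   <⟨ +-monoˡ-< _ (toℕ<n e) ⟩
        m G + (degree G (src e) + degree G (tgt e))     ≤⟨ +-monoʳ-≤ (m G) (+-mono-≤ (degree≤Δ (src e)) (degree≤Δ (tgt e))) ⟩
        m G + (Δ G + Δ G)                               ≡⟨ cong (λ x → m G + (Δ G + x)) (sym (+-identityʳ (Δ G))) ⟩
        m G + 2 * Δ G                                   ≡⟨ sym |W| ⟩
        length W                                        ∎
        where open ≤-Reasoning

      extension : Unique W → length W ≡ m G + 2 * Δ G → ∃ (Partial (suc (toℕ e)))
      extension uniq |W| with c , c∈W , c∉ ← pigeonhole-∉ {W} {forbidden} uniq (forbidden-shorter |W|) =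
        w′ c∈W c∉ , extended c∈W c∉

    partial : Nice G → Unique W → length W ≡ m G + 2 * Δ G → ∀ k → k ≤ m G → ∃ (Partial k)
    partial nice uniq |W| zero    _   = _ , partial₀ nice
    partial nice uniq |W| (suc k) k<m with w , P ← partial nice uniq |W| k (<⇒≤ k<m) =
      subst (λ k → ∃ (Partial (suc k))) e≡k
        (Extension.extension e (subst (λ k → Partial k w) (sym e≡k) P) uniq |W|)
      where
      e : Edge G
      e = fromℕ< k<m
      e≡k : toℕ e ≡ k
      e≡k = toℕ-fromℕ< k<m

theorem4p2 : (G : Graph) → Nice G →
    (W : List ℕ) → Unique W → All (λ x → 0 < x) W → length W ≡ m G + 2 * Δ G →
    Σ (Weighting G) (λ w → IsWWeighting G W w × EdgeInjective G w × NeighbourSumDistinguishing G w)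
theorem4p2 G nice W uniq _ |W| with w , P ← partial G W nice uniq |W| (m G) ≤-refl =
  let open Partial P in
  w , (λ i → assigned-∈ i (toℕ<n i))
    , (λ {i} {j} → assigned-injective (toℕ<n i) (toℕ<n j))
    , (λ j → settled-distinguished j (λ i _ _ → toℕ<n i))
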